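{- Every gerechte framework has a row-realization.
   Context: A gerechte framework of order $n$ is a partition of the cells of an $n\times n$ array into $n$ regions, each containing $n$ cells. A row-latin square of order $n$ is an $n\times n$ array with symbols $1,\dots,n$ in which each symbol appears exactly once in each row. A row-realization of a gerechte framework $F$ of order $n$ is a row-latin square of order $n$ such that, when its cells are partitioned by $F$, each symbol appears exactly once in each region. -}

module Defs where

open import Data.Nat using (ℕ)
open import Data.Fin using (Fin)
open import Data.Fin.Properties using (_≟_)
open import Data.Product using (_×_; _,_; proj₁; proj₂; Σ)
open import Data.List using (List; length; filter; allFin; cartesianProduct)
open import Relation.Nullary using (Dec)
open import Relation.Binary.PropositionalEquality using (_≡_)

Array : ℕ → Set
Array n = Fin n → Fin n → Fin n

cells : (n : ℕ) → List (Fin n × Fin n)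
cells n = cartesianProduct (allFin n) (allFin n)

cellCount : ∀ {n} → Array n → Fin n → ℕ
cellCount {n} F r = length (filter (λ c → F (proj₁ c) (proj₂ c) ≟ r) (cells n))

-- A gerechte framework of order n: a partition of the cells into n regions
-- (labelled by Fin n; F i j is the region containing cell (i , j)),
-- each region containing exactly n cells.
IsGerechteFramework : ∀ {n} → Array n → Set
IsGerechteFramework {n} F = (r : Fin n) → cellCount F r ≡ n

rowCount : ∀ {n} → Array n → Fin n → Fin n → ℕ
rowCount {n} L i s = length (filter (λ j → L i j ≟ s) (allFin n))

IsRowLatin : ∀ {n} → Array n → Set
IsRowLatin {n} L = (i s : Fin n) → rowCount L i s ≡ 1

regionCount : ∀ {n} → Array n → Array n → Fin n → Fin n → ℕ
regionCount {n} F L r s =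
  length (filter (λ c → F (proj₁ c) (proj₂ c) ≟ r) (filter (λ c → L (proj₁ c) (proj₂ c) ≟ s) (cells n)))

IsRowRealization : ∀ {n} → Array n → Array n → Set
IsRowRealization {n} F L = IsRowLatin L × ((r s : Fin n) → regionCount F L r s ≡ 1)

-- Rows and regions are the two vertex classes of a bipartite multigraph whose edges are the
-- cells, cell (i , j) joining row i to region F i j. Every vertex has degree n (a row has n
-- columns, a region has n cells), so by Kőnig's edge-colouring theorem the cells can be coloured
-- with n symbols such that no two cells of a row or of a region share a symbol; in a row or region
-- of n cells that means every symbol occurs exactly once. Kőnig's theorem is proved by colouring
-- the edges one at a time: an uncoloured edge uv sees a colour a free at u and a colour b free at
-- v, and swapping a and b along the alternating path starting at v frees a at v without using it
-- at u, since in a bipartite graph that path cannot reach u.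
module Submission where

open import Data.Bool using (Bool; true; false; not)
open import Data.Bool.Properties using (not-¬; ¬-not) renaming (_≟_ to _≟ᴮ_)
open import Data.Fin using (Fin; zero; suc; punchOut)
open import Data.Fin.Properties using (injective⇒≤; punchOut-injective; any?; all?; ¬∀⟶∃¬)
  renaming (_≟_ to _≟ᶠ_)
open import Data.List using (List; []; _∷_; length; filter)
open import Data.List.Membership.Propositional using (_∈_; lose)
open import Data.List.Membership.Propositional.Properties
  using (∈-filter⁺; ∈-filter⁻; ∈-cartesianProduct⁺; ∈-allFin)
import Data.List.Membership.Setoid.Properties as SetoidMembership
open import Data.List.Properties using (filter-accept; filter-reject; filter-none)
open import Data.List.Relation.Unary.All using (tabulate; lookup)
open import Data.List.Relation.Unary.AllPairs using (_∷_)
open import Data.List.Relation.Unary.Any as Any using (here; there; index; satisfied)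
open import Data.List.Relation.Unary.Unique.Propositional using (Unique)
open import Data.List.Relation.Unary.Unique.Propositional.Properties
  using (allFin⁺; cartesianProduct⁺; filter⁺)
open import Data.Maybe using (Maybe; just; nothing)
open import Data.Maybe.Properties using (just-injective) renaming (≡-dec to ≡-decᴹ)
open import Data.Nat using (ℕ; zero; suc; _≤_; _<_; z≤n; s≤s)
open import Data.Nat.Properties using (≤-refl; m≤n⇒m≤1+n; <-≤-trans; n≮n)
open import Data.Product using (Σ; ∃; _×_; _,_; proj₁; proj₂; curry; uncurry)
open import Data.Product.Properties using () renaming (≡-dec to ≡-dec×)
open import Data.Sum using (_⊎_; inj₁; inj₂)
open import Function using (_∘_)
open import Function.Definitions using (Injective)
open import Level using (0ℓ)
open import Relation.Binary.Definitions using (DecidableEquality)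
open import Relation.Binary.PropositionalEquality
open import Relation.Nullary using (¬_; Dec; yes; no; ¬?; contradiction)
open import Relation.Nullary.Decidable using (_×-dec_; map′)
open import Relation.Unary using (Pred; Decidable; _⊆_)

open import Defs

module _ {A : Set} {P Q : Pred A 0ℓ} (P? : Decidable P) (Q? : Decidable Q) (P⊆Q : P ⊆ Q) where

  length-filter-⊆ : ∀ xs → length (filter P? xs) ≤ length (filter Q? xs)
  length-filter-⊆ [] = z≤n
  length-filter-⊆ (y ∷ xs) with P? y | Q? y
  ... | yes _  | yes _  = s≤s (length-filter-⊆ xs)
  ... | yes py | no ¬qy = contradiction (P⊆Q py) ¬qy
  ... | no _   | yes _  = m≤n⇒m≤1+n (length-filter-⊆ xs)
  ... | no _   | no _   = length-filter-⊆ xs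

  length-filter-⊂ : ∀ {x} xs → x ∈ xs → Q x → ¬ P x → length (filter P? xs) < length (filter Q? xs)
  length-filter-⊂ (y ∷ xs) (here refl) qy ¬py with P? y | Q? y
  ... | yes py | _      = contradiction py ¬py
  ... | no _   | yes _  = s≤s (length-filter-⊆ xs)
  ... | no _   | no ¬qy = contradiction qy ¬qy
  length-filter-⊂ (y ∷ xs) (there x∈xs) qx ¬px with P? y | Q? y
  ... | yes _  | yes _  = s≤s (length-filter-⊂ xs x∈xs qx ¬px)
  ... | yes py | no ¬qy = contradiction (P⊆Q py) ¬qy
  ... | no _   | yes _  = m≤n⇒m≤1+n (length-filter-⊂ xs x∈xs qx ¬px)
  ... | no _   | no _   = length-filter-⊂ xs x∈xs qx ¬px

module _ {A : Set} {P : Pred A 0ℓ} (P? : Decidable P) where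

  length-filter-unique≡1 : ∀ {x xs} → Unique xs → x ∈ xs → P x →
                           (∀ {y} → y ∈ xs → P y → y ≡ x) → length (filter P? xs) ≡ 1
  length-filter-unique≡1 {xs = y ∷ xs} (y∉xs ∷ _) (here refl) py only-x = begin
    length (filter P? (y ∷ xs)) ≡⟨ cong length (filter-accept P? py) ⟩
    suc (length (filter P? xs)) ≡⟨ cong (suc ∘ length) (filter-none P? (tabulate ¬P)) ⟩
    1                           ∎
    where
    open ≡-Reasoning
    ¬P : ∀ {z} → z ∈ xs → ¬ P z
    ¬P z∈xs pz = lookup y∉xs z∈xs (sym (only-x (there z∈xs) pz))
  length-filter-unique≡1 {xs = y ∷ xs} (y∉xs ∷ u) (there x∈xs) px only-x = begin
    length (filter P? (y ∷ xs)) ≡⟨ cong length (filter-reject P? ¬py) ⟩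
    length (filter P? xs)       ≡⟨ length-filter-unique≡1 u x∈xs px (only-x ∘ there) ⟩
    1                           ∎
    where
    open ≡-Reasoning
    ¬py : ¬ P y
    ¬py py = lookup y∉xs x∈xs (only-x (here refl) py)

injective⇒≤length : ∀ {A : Set} {m} (xs : List A) (g : Fin m → A) →
                    Injective _≡_ _≡_ g → (∀ i → g i ∈ xs) → m ≤ length xs
injective⇒≤length xs g g-inj g∈xs = injective⇒≤ {f = index ∘ g∈xs} λ {i} {j} eq →
  g-inj (SetoidMembership.index-injective (setoid _) (g∈xs i) (g∈xs j) eq)

injective⇒surjective : ∀ {n} (f : Fin n → Fin n) → Injective _≡_ _≡_ f → ∀ y → ∃ λ x → f x ≡ y
injective⇒surjective {zero}  f f-inj ()
injective⇒surjective {suc n} f f-inj y with any? (λ x → f x ≟ᶠ y)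
... | yes hit = hit
... | no miss = contradiction (injective⇒≤ {f = g} g-inj) (n≮n n)
  where
  y≢f : ∀ x → y ≢ f x
  y≢f x y≡fx = miss (x , sym y≡fx)
  g : Fin (suc n) → Fin n
  g x = punchOut (y≢f x)
  g-inj : Injective _≡_ _≡_ g
  g-inj {x} {x'} eq = f-inj (punchOut-injective (y≢f x) (y≢f x') eq)

-- A bipartite multigraph is given by its edges E and the map end: edge e joins the vertex
-- end true e of one side to the vertex end false e of the other.
MaxDegree : {E V : Set} → (Bool → E → V) → ℕ → Set
MaxDegree {E} end n =
  ∀ t v {m} (g : Fin m → E) → Injective _≡_ _≡_ g → (∀ i → end t (g i) ≡ v) → m ≤ n

ProperEdgeColouring : {E V K : Set} → (Bool → E → V) → (E → K) → Set
ProperEdgeColouring end c = ∀ t {e e'} → end t e ≡ end t e' → c e ≡ c e' → e ≡ e'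

module Kőnig {E V : Set} (_≟ᴱ_ : DecidableEquality E) (_≟ⱽ_ : DecidableEquality V)
             (edges : List E) (∈-edges : ∀ e → e ∈ edges)
             (end : Bool → E → V) (n : ℕ) (maxDegree : MaxDegree end n) where

  PartialColouring : Set
  PartialColouring = E → Maybe (Fin n)

  _≟ᴹ_ : DecidableEquality (Maybe (Fin n))
  _≟ᴹ_ = ≡-decᴹ _≟ᶠ_

  Coloured : PartialColouring → E → Set
  Coloured C e = C e ≢ nothing

  Proper : PartialColouring → Set
  Proper C = ∀ t {e e' p} → end t e ≡ end t e' → C e ≡ just p → C e' ≡ just p → e ≡ e'

  Present : PartialColouring → Bool → V → Fin n → Set
  Present C t v p = ∃ λ e → end t e ≡ v × C e ≡ just p

  Missing : PartialColouring → Bool → V → Fin n → Set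
  Missing C t v p = ¬ Present C t v p

  present? : ∀ C t v p → Dec (Present C t v p)
  present? C t v p = map′ satisfied (λ (e , h) → lose (∈-edges e) h)
    (Any.any? (λ e → (end t e ≟ⱽ v) ×-dec (C e ≟ᴹ just p)) edges)

  colouredCount : PartialColouring → ℕ
  colouredCount C = length (filter (λ e → ¬? (C e ≟ᴹ nothing)) edges)

  _[_≔_] : PartialColouring → E → Maybe (Fin n) → PartialColouring
  (C [ e ≔ m ]) e' with e' ≟ᴱ e
  ... | yes _ = m
  ... | no _  = C e'

  [≔]-≡ : ∀ C e m → (C [ e ≔ m ]) e ≡ m
  [≔]-≡ C e m with e ≟ᴱ e
  ... | yes _   = refl
  ... | no e≢e = contradiction refl e≢e

  [≔]-≢ : ∀ C {e e'} m → e' ≢ e → (C [ e ≔ m ]) e' ≡ C e'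
  [≔]-≢ C {e} {e'} m e'≢e with e' ≟ᴱ e
  ... | yes e'≡e = contradiction e'≡e e'≢e
  ... | no _     = refl

  uncolour-⊆ : ∀ C e {e' p} → (C [ e ≔ nothing ]) e' ≡ just p → C e' ≡ just p
  uncolour-⊆ C e {e'} h with e' ≟ᴱ e
  uncolour-⊆ C e () | yes _
  ... | no _ = h

  uncolour-proper : ∀ {C} e → Proper C → Proper (C [ e ≔ nothing ])
  uncolour-proper {C} e proper t ends e↦p e'↦p =
    proper t ends (uncolour-⊆ C e e↦p) (uncolour-⊆ C e e'↦p)

  uncolour-missing : ∀ {C} e {t v p} → Missing C t v p → Missing (C [ e ≔ nothing ]) t v p
  uncolour-missing {C} e v∌p (e' , e'∼v , e'↦p) = v∌p (e' , e'∼v , uncolour-⊆ C e e'↦p)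

  uncolour-coloured : ∀ {C e e'} → e' ≢ e → Coloured C e' → Coloured (C [ e ≔ nothing ]) e'
  uncolour-coloured {C} {e} e'≢e c = c ∘ trans (sym ([≔]-≢ C nothing e'≢e))

  uncolour-count< : ∀ C {e p} → C e ≡ just p →
                    colouredCount (C [ e ≔ nothing ]) < colouredCount C
  uncolour-count< C {e} e↦p = length-filter-⊂
    (λ e' → ¬? ((C [ e ≔ nothing ]) e' ≟ᴹ nothing)) (λ e' → ¬? (C e' ≟ᴹ nothing))
    still-coloured edges (∈-edges e) (λ e↦∅ → contradiction (trans (sym e↦p) e↦∅) λ ())
    (λ c → c ([≔]-≡ C e nothing))
    where
    still-coloured : ∀ {e'} → Coloured (C [ e ≔ nothing ]) e' → Coloured C e'
    still-coloured {e'} c with e' ≟ᴱ e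
    ... | yes _ = contradiction refl c
    ... | no _  = c

  uncolour-frees : ∀ {C} → Proper C → ∀ {e p} → C e ≡ just p →
                   ∀ t → Missing (C [ e ≔ nothing ]) t (end t e) p
  uncolour-frees {C} proper {e} e↦p t (e' , e'∼e , e'↦p)
    with proper t e'∼e (uncolour-⊆ C e e'↦p) e↦p
  ... | refl with () ← trans (sym e'↦p) ([≔]-≡ C e nothing)

  assign-present : ∀ {C e r t v p} → Present (C [ e ≔ just r ]) t v p →
                   (end t e ≡ v × r ≡ p) ⊎ Present C t v p
  assign-present {e = e} (e' , e'∼v , e'↦p) with e' ≟ᴱ e
  ... | yes refl = inj₁ (e'∼v , just-injective e'↦p)
  ... | no _     = inj₂ (e' , e'∼v , e'↦p)

  assign-missing : ∀ {C e r t v p} → (end t e ≡ v → r ≢ p) → Missing C t v p →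
                   Missing (C [ e ≔ just r ]) t v p
  assign-missing e∼v⇒r≢p v∌p v∋p with assign-present v∋p
  ... | inj₁ (e∼v , r≡p) = e∼v⇒r≢p e∼v r≡p
  ... | inj₂ v∋p′        = v∌p v∋p′

  assign-coloured : ∀ {C e e'} r → Coloured C e' → Coloured (C [ e ≔ just r ]) e'
  assign-coloured {C} {e} {e'} r c with e' ≟ᴱ e
  ... | yes _ = λ ()
  ... | no _  = c

  missing-at-both-ends : ∀ {C e r} s → Missing C s (end s e) r →
                         Missing C (not s) (end (not s) e) r → ∀ t → Missing C t (end t e) r
  missing-at-both-ends s s∌r _ t with t ≟ᴮ s
  missing-at-both-ends s s∌r _   t | yes refl = s∌r
  missing-at-both-ends {C} {e} {r} s _ ¬s∌r t | no t≢s =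
    subst (λ t → Missing C t (end t e) r) (sym (¬-not t≢s)) ¬s∌r

  assign-proper : ∀ {C e r} → Proper C → (∀ t → Missing C t (end t e) r) →
                  Proper (C [ e ≔ just r ])
  assign-proper {C} {e} proper e∌r t {e₁} {e₂} ends e₁↦p e₂↦p with e₁ ≟ᴱ e | e₂ ≟ᴱ e
  ... | yes refl | yes refl = refl
  ... | yes refl | no _ with refl ← just-injective e₁↦p =
    contradiction (e₂ , sym ends , e₂↦p) (e∌r t)
  ... | no _ | yes refl with refl ← just-injective e₂↦p =
    contradiction (e₁ , ends , e₁↦p) (e∌r t)
  ... | no _ | no _ = proper t ends e₁↦p e₂↦p

  -- The effect of swapping p and q along the alternating path that starts at w with a p-edge.
  -- Only the far end of the path gains a colour, which the last three fields make precise.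
  record KempeSwap (C : PartialColouring) (s : Bool) (w : V) (p q : Fin n) : Set where
    field
      swapped        : PartialColouring
      proper         : Proper swapped
      keeps-coloured : ∀ {e} → Coloured C e → Coloured swapped e
      frees-p        : Missing swapped s w p
      p-not-added    : ∀ {t z} → t ≢ s → Missing C t z p → Missing swapped t z p
      q-not-added    : ∀ {z} → z ≢ w → Missing C s z q → Missing swapped s z q
      pq-not-added   : ∀ {t z} → Missing C t z p → Missing C t z q →
                       Missing swapped t z p × Missing swapped t z q

  no-swap : ∀ {C s w p q} → Proper C → Missing C s w p → KempeSwap C s w p q
  no-swap {C} proper w∌p = record
    { swapped = C ; proper = proper ; keeps-coloured = λ c → c ; frees-p = w∌p
    ; p-not-added = λ _ z∌p → z∌p ; q-not-added = λ _ z∌q → z∌q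
    ; pq-not-added = λ z∌p z∌q → z∌p , z∌q }

  -- The first edge e₁ of the path is uncoloured, the rest of the path is swapped recursively
  -- (from the other end of e₁, with the roles of p and q exchanged), and e₁ is recoloured q.
  module SwapStep {C s p q e₁} (C-proper : Proper C) (e₁↦p : C e₁ ≡ just p)
                  (w∌q : Missing C s (end s e₁) q)
                  (rest : KempeSwap (C [ e₁ ≔ nothing ]) (not s) (end (not s) e₁) q p) where

    open KempeSwap rest renaming (swapped to C₂; proper to C₂-proper)

    w : V
    w = end s e₁

    q≢p : q ≢ p
    q≢p refl = w∌q (e₁ , refl , e₁↦p)

    avoids : ∀ {t z} → Missing C t z p → end t e₁ ≢ z
    avoids z∌p e₁∼z = z∌p (e₁ , e₁∼z , e₁↦p)

    w-clear : Missing C₂ s w p × Missing C₂ s w q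
    w-clear with w∌q₂ , w∌p₂ ← pq-not-added (uncolour-missing e₁ w∌q) (uncolour-frees C-proper e₁↦p s)
      = w∌p₂ , w∌q₂

    swap : KempeSwap C s w p q
    swap = record
      { swapped        = C₂ [ e₁ ≔ just q ]
      ; proper         = assign-proper C₂-proper (missing-at-both-ends s (proj₂ w-clear) frees-p)
      ; keeps-coloured = coloured
      ; frees-p        = assign-missing (λ _ → q≢p) (proj₁ w-clear)
      ; p-not-added    = p-not-added′
      ; q-not-added    = λ z≢w z∌q → assign-missing (λ w≡z _ → z≢w (sym w≡z))
                           (KempeSwap.p-not-added rest (not-¬ refl) (uncolour-missing e₁ z∌q))
      ; pq-not-added   = pq-not-added′
      }
      where
      coloured : ∀ {e} → Coloured C e → Coloured (C₂ [ e₁ ≔ just q ]) e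
      coloured {e} c with e ≟ᴱ e₁
      ... | yes refl = λ ()
      ... | no e≢e₁  = keeps-coloured (uncolour-coloured e≢e₁ c)

      p-not-added′ : ∀ {t z} → t ≢ s → Missing C t z p → Missing (C₂ [ e₁ ≔ just q ]) t z p
      p-not-added′ t≢s z∌p with refl ← ¬-not t≢s = assign-missing (λ _ → q≢p)
        (q-not-added (avoids z∌p ∘ sym) (uncolour-missing e₁ z∌p))

      pq-not-added′ : ∀ {t z} → Missing C t z p → Missing C t z q →
                      Missing (C₂ [ e₁ ≔ just q ]) t z p × Missing (C₂ [ e₁ ≔ just q ]) t z q
      pq-not-added′ z∌p z∌q
        with z∌q₂ , z∌p₂ ← pq-not-added (uncolour-missing e₁ z∌q) (uncolour-missing e₁ z∌p) =
        assign-missing (λ _ → q≢p) z∌p₂ , assign-missing (λ e₁∼z _ → avoids z∌p e₁∼z) z∌q₂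

  -- Every step uncolours an edge, so the number of coloured edges bounds the recursion depth.
  kempe-swap : ∀ k C → colouredCount C < k → Proper C → ∀ s w p q → Missing C s w q →
               KempeSwap C s w p q
  kempe-swap (suc k) C (s≤s count≤k) proper s w p q w∌q with present? C s w p
  ... | no w∌p = no-swap proper w∌p
  ... | yes (e₁ , refl , e₁↦p) = SwapStep.swap proper e₁↦p w∌q
    (kempe-swap k (C [ e₁ ≔ nothing ]) (<-≤-trans (uncolour-count< C e₁↦p) count≤k)
                (uncolour-proper e₁ proper) (not s) (end (not s) e₁) q p
                (uncolour-frees proper e₁↦p (not s)))

  -- If every colour were present at an endpoint of the uncoloured edge e, that vertex would have
  -- degree n + 1.
  free-colour : ∀ C {e} → C e ≡ nothing → ∀ t → ∃ λ p → Missing C t (end t e) p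
  free-colour C {e} e↦∅ t with all? (λ p → present? C t (end t e) p)
  ... | no ¬all  = ¬∀⟶∃¬ n _ (λ p → present? C t (end t e) p) ¬all
  ... | yes all = contradiction (maxDegree t (end t e) g g-inj g∼v) (n≮n n)
    where
    g : Fin (suc n) → E
    g zero    = e
    g (suc p) = proj₁ (all p)

    g↦ : ∀ p → C (g (suc p)) ≡ just p
    g↦ p = proj₂ (proj₂ (all p))

    g∼v : ∀ i → end t (g i) ≡ end t e
    g∼v zero    = refl
    g∼v (suc p) = proj₁ (proj₂ (all p))

    g-inj : Injective _≡_ _≡_ g
    g-inj {zero}  {zero}   _  = refl
    g-inj {zero}  {suc p}  eq with () ← trans (sym e↦∅) (trans (cong C eq) (g↦ p))
    g-inj {suc p} {zero}   eq with () ← trans (sym e↦∅) (trans (cong C (sym eq)) (g↦ p))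
    g-inj {suc p} {suc p'} eq =
      cong suc (just-injective (trans (sym (g↦ p)) (trans (cong C eq) (g↦ p'))))

  colour-edge : ∀ C → Proper C → ∀ e → C e ≡ nothing →
                ∃ λ C' → Proper C' × Coloured C' e × (∀ {e'} → Coloured C e' → Coloured C' e')
  colour-edge C proper e e↦∅
    with a , u∌a ← free-colour C e↦∅ true | b , v∌b ← free-colour C e↦∅ false =
      C₂ [ e ≔ just a ]
    , assign-proper C₂-proper (missing-at-both-ends false frees-p (p-not-added (λ ()) u∌a))
    , (λ e↦∅′ → contradiction (trans (sym ([≔]-≡ C₂ e (just a))) e↦∅′) λ ())
    , assign-coloured a ∘ keeps-coloured
    where
    open KempeSwap (kempe-swap (suc (colouredCount C)) C ≤-refl proper false (end false e) a b v∌b)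
      renaming (swapped to C₂; proper to C₂-proper)

  colour-all : ∀ es → ∃ λ C → Proper C × (∀ {e} → e ∈ es → Coloured C e)
  colour-all [] = (λ _ → nothing) , (λ _ _ ()) , λ ()
  colour-all (e ∷ es) with colour-all es
  ... | C , proper , es-coloured with C e ≟ᴹ nothing
  ... | no e-coloured = C , proper , λ { (here refl) → e-coloured ; (there e'∈es) → es-coloured e'∈es }
  ... | yes e↦∅ with colour-edge C proper e e↦∅
  ... | C' , proper' , e-coloured , keeps =
        C' , proper' , λ { (here refl) → e-coloured ; (there e'∈es) → keeps (es-coloured e'∈es) }

  proper-edge-colouring : Σ (E → Fin n) (ProperEdgeColouring end)
  proper-edge-colouring with C , C-proper , all-coloured ← colour-all edges =
    colour , λ t ends same →
      C-proper t ends (colour-spec _) (trans (colour-spec _) (cong just (sym same)))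
    where
    total : ∀ e → ∃ λ p → C e ≡ just p
    total e with C e | all-coloured (∈-edges e)
    ... | just p  | _ = p , refl
    ... | nothing | c = contradiction refl c

    colour : E → Fin n
    colour = proj₁ ∘ total

    colour-spec : ∀ e → C e ≡ just (colour e)
    colour-spec = proj₂ ∘ total

row-or-region : ∀ {n} → Array n → Bool → Fin n × Fin n → Fin n
row-or-region F true  = proj₁
row-or-region F false = uncurry F

∈-cells : ∀ {n} (c : Fin n × Fin n) → c ∈ cells n
∈-cells (i , j) = ∈-cartesianProduct⁺ (∈-allFin i) (∈-allFin j)

unique-cells : ∀ n → Unique (cells n)
unique-cells n = cartesianProduct⁺ (allFin⁺ n) (allFin⁺ n)

gerechte⇒maxDegree : ∀ {n} (F : Array n) → IsGerechteFramework F → MaxDegree (row-or-region F) n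
gerechte⇒maxDegree F _ true i g g-inj g∼i =
  injective⇒≤ {f = proj₂ ∘ g} λ {x} {y} eq → g-inj (cong₂ _,_ (trans (g∼i x) (sym (g∼i y))) eq)
gerechte⇒maxDegree {n} F regions-of-size-n false r g g-inj g∼r = subst (_ ≤_) (regions-of-size-n r)
  (injective⇒≤length _ g g-inj λ x → ∈-filter⁺ (λ c → uncurry F c ≟ᶠ r) (∈-cells (g x)) (g∼r x))

module _ {n} (F : Array n) {L : Fin n × Fin n → Fin n} (proper : ProperEdgeColouring (row-or-region F) L) where

  row-injective : ∀ i → Injective _≡_ _≡_ (curry L i)
  row-injective i eq = cong proj₂ (proper true refl eq)

  row-latin : IsRowLatin (curry L)
  row-latin i s with j , Lij≡s ← injective⇒surjective (curry L i) (row-injective i) s =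
    length-filter-unique≡1 (λ j → L (i , j) ≟ᶠ s) (allFin⁺ n) (∈-allFin j) Lij≡s
      λ _ Lij'≡s → row-injective i (trans Lij'≡s (sym Lij≡s))

  column-of : Fin n → Fin n → Fin n
  column-of s i = proj₁ (injective⇒surjective (curry L i) (row-injective i) s)

  column-of-spec : ∀ s i → L (i , column-of s i) ≡ s
  column-of-spec s i = proj₂ (injective⇒surjective (curry L i) (row-injective i) s)

  region-of-injective : ∀ s → Injective _≡_ _≡_ (λ i → F i (column-of s i))
  region-of-injective s same-region =
    cong proj₁ (proper false same-region (trans (column-of-spec s _) (sym (column-of-spec s _))))

  region-once : ∀ r s → regionCount F (curry L) r s ≡ 1
  region-once r s with i , in-r ← injective⇒surjective _ (region-of-injective s) r =
    length-filter-unique≡1 (λ c → uncurry F c ≟ᶠ r)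
      (filter⁺ (λ c → L c ≟ᶠ s) (unique-cells n))
      (∈-filter⁺ (λ c → L c ≟ᶠ s) (∈-cells (i , column-of s i)) (column-of-spec s i))
      in-r
      λ {c} c∈ c-in-r → proper false (trans c-in-r (sym in-r))
        (trans (proj₂ (∈-filter⁻ (λ c → L c ≟ᶠ s) {xs = cells n} c∈)) (sym (column-of-spec s i)))

lemma8 : (n : ℕ) (F : Array n) → IsGerechteFramework F → Σ (Array n) (λ L → IsRowRealization F L)
lemma8 n F gerechte
  with L , L-proper ← Kőnig.proper-edge-colouring (≡-dec× _≟ᶠ_ _≟ᶠ_) _≟ᶠ_ (cells n) ∈-cells
                        (row-or-region F) n (gerechte⇒maxDegree F gerechte)
  = curry L , row-latin F L-proper , region-once F L-proper
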